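{- For every $f\in\mathrm{QSL}[\mathfrak{A}]$, $|\mathrm{Eval}(f)|\le 2^{|f|_{p}+1}$.
   Context: $\mathfrak{A}$ is a set of predicates (sets of stack–heap states); $\mathrm{SL}[\mathfrak{A}]$ is separation logic with atoms from $\mathfrak{A}$. $\mathrm{QSL}[\mathfrak{A}]$ formulae: $f ::= [\varphi] \mid [b]\cdot f + [\neg b]\cdot f \mid q\cdot f+(1-q)\cdot f \mid f\cdot f\mid 1-f\mid \max(f,f)\mid\min(f,f)\mid \mathsf{S}x\colon f\mid \mathsf{J}x\colon f\mid f\star f\mid [\varphi]\mathbin{ -\!\!\star} f$, with $\varphi\in\mathrm{SL}[\mathfrak{A}]$, $b$ a pure $\mathrm{SL}[\mathfrak{A}]$ formula, $q\in\mathbb{Q}\cap[0,1]$. Evaluation set: $\mathrm{Eval}([\varphi])=\{0,1\}$; $\mathrm{Eval}([b]\cdot g+[\neg b]\cdot u)=\mathrm{Eval}(g)\cup\mathrm{Eval}(u)$; $\mathrm{Eval}(q\cdot g+(1-q)\cdot u)=\{q\beta+(1-q)\gamma\mid\beta\in\mathrm{Eval}(g),\gamma\in\mathrm{Eval}(u)\}$; $\mathrm{Eval}(g\cdot u)=\mathrm{Eval}(g\star u)=\{\beta\gamma\mid\beta\in\mathrm{Eval}(g),\gamma\in\mathrm{Eval}(u)\}$; $\mathrm{Eval}(1-g)=\{1-\beta\mid\beta\in\mathrm{Eval}(g)\}$; $\mathrm{Eval}(\max(g,u))=\mathrm{Eval}(\min(g,u))=\mathrm{Eval}(g)\cup\mathrm{Eval}(u)$;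 $\mathrm{Eval}(\mathsf{S}x\colon g)=\mathrm{Eval}(\mathsf{J}x\colon g)=\mathrm{Eval}([\varphi]\mathbin{ -\!\!\star} g)=\mathrm{Eval}(g)$. Probabilistic size $|f|_p$: $|[\varphi]|_p=0$; $|q\cdot g+(1-q)\cdot u|_p=|g\cdot u|_p=|g\star u|_p=1+|g|_p+|u|_p$; $|[b]\cdot g+[\neg b]\cdot u|_p=|\max(g,u)|_p=|\min(g,u)|_p=|g|_p+|u|_p$; $|1-g|_p=|\mathsf{S}x\colon g|_p=|\mathsf{J}x\colon g|_p=|[\varphi]\mathbin{ -\!\!\star} g|_p=|g|_p$. -}

module Defs where

open import Data.Nat using (ℕ; suc; _+_)
open import Data.Rational using (ℚ; 0ℚ; 1ℚ; _≤_; _*_; _-_)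
  renaming (_+_ to _+ℚ_)
open import Data.Product using (Σ; _×_)
open import Data.Sum using (_⊎_)
open import Relation.Binary.PropositionalEquality using (_≡_)

-- The QSL layer is parametric in:
--   Φ    : the type of SL[𝔄] formulae (for an arbitrary atom set 𝔄),
--   Pure : which SL[𝔄] formulae are pure,
--   V    : the type of (stack) variables.
-- Neither Eval nor |_|_p depends on these, so they are kept abstract.
data QSL (Φ : Set) (Pure : Φ → Set) (V : Set) : Set where
  [_]      : Φ → QSL Φ Pure V
  -- [b]·g + [¬b]·u  with b pure
  guarded  : (b : Φ) → Pure b → QSL Φ Pure V → QSL Φ Pure V → QSL Φ Pure V
  -- q·g + (1-q)·u  with q ∈ ℚ ∩ [0,1]
  pchoice  : (q : ℚ) → 0ℚ ≤ q → q ≤ 1ℚ → QSL Φ Pure V → QSL Φ Pure V → QSL Φ Pure V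
  mul      : QSL Φ Pure V → QSL Φ Pure V → QSL Φ Pure V
  oneMinus : QSL Φ Pure V → QSL Φ Pure V
  qmax     : QSL Φ Pure V → QSL Φ Pure V → QSL Φ Pure V
  qmin     : QSL Φ Pure V → QSL Φ Pure V → QSL Φ Pure V
  supx     : V → QSL Φ Pure V → QSL Φ Pure V
  infx     : V → QSL Φ Pure V → QSL Φ Pure V
  sepcon   : QSL Φ Pure V → QSL Φ Pure V → QSL Φ Pure V
  wand     : Φ → QSL Φ Pure V → QSL Φ Pure V

module _ {Φ : Set} {Pure : Φ → Set} {V : Set} where

  Eval : QSL Φ Pure V → ℚ → Set
  Eval [ φ ] β = β ≡ 0ℚ ⊎ β ≡ 1ℚ
  Eval (guarded b _ g u) β = Eval g β ⊎ Eval u β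
  Eval (pchoice q _ _ g u) β =
    Σ ℚ λ x → Σ ℚ λ y → Eval g x × Eval u y × (β ≡ (q * x) +ℚ ((1ℚ - q) * y))
  Eval (mul g u) β = Σ ℚ λ x → Σ ℚ λ y → Eval g x × Eval u y × (β ≡ x * y)
  Eval (oneMinus g) β = Σ ℚ λ x → Eval g x × (β ≡ 1ℚ - x)
  Eval (qmax g u) β = Eval g β ⊎ Eval u β
  Eval (qmin g u) β = Eval g β ⊎ Eval u β
  Eval (supx _ g) β = Eval g β
  Eval (infx _ g) β = Eval g β
  Eval (sepcon g u) β = Σ ℚ λ x → Σ ℚ λ y → Eval g x × Eval u y × (β ≡ x * y)
  Eval (wand _ g) β = Eval g β

  psize : QSL Φ Pure V → ℕ
  psize [ _ ] = 0
  psize (guarded _ _ g u) = psize g + psize u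
  psize (pchoice _ _ _ g u) = suc (psize g + psize u)
  psize (mul g u) = suc (psize g + psize u)
  psize (oneMinus g) = psize g
  psize (qmax g u) = psize g + psize u
  psize (qmin g u) = psize g + psize u
  psize (supx _ g) = psize g
  psize (infx _ g) = psize g
  psize (sepcon g u) = suc (psize g + psize u)
  psize (wand _ g) = psize g

{-# OPTIONS --safe #-}
-- Eval f always contains 0 and 1, and every QSL operation fixes them (1 − · swaps them), so we
-- bound r f, the number of other values, by 2 + r f ≤ 2 ^ (|f|ₚ + 1).  A binary operation h with
-- h 0 0 = 0 and h 1 1 = 1 yields at most (2 + r g) (2 + r u) values, and the product
-- 2 ^ (|g|ₚ + 1) · 2 ^ (|u|ₚ + 1) is paid for by the + 1 in |·|ₚ.  A union yields r g + r u other
-- values, and 2 s + 2 t − 2 ≤ 2 s t for s, t ≥ 1 is why unions cost nothing.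
module Submission where

open import Defs
open import Data.Nat using (_≤_; _^_; _+_)
open import Data.Rational using (ℚ)
open import Data.List using (List; length)
open import Data.List.Relation.Unary.All using (All)
open import Data.List.Relation.Unary.Unique.Propositional using (Unique)

open import Data.Nat using (ℕ; suc; _*_; z≤n; s≤s)
open import Data.Nat.Properties
  using (≤-refl; +-comm; +-suc; +-mono-≤; *-mono-≤; *-monoʳ-≤; *-distribˡ-+; m≤m+n; m^n>0; +-cancelʳ-≤; ^-distribˡ-+-*; module ≤-Reasoning)
open import Data.Nat.Tactic.RingSolver using (solve-∀)
open import Data.Rational using (0ℚ; 1ℚ; -_) renaming (_+_ to _+ℚ_; _*_ to _*ℚ_; _-_ to _-ℚ_)
import Data.Rational.Properties as ℚ
open import Data.List using ([]; _∷_; map; _++_; cartesianProductWith)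
open import Data.List.Properties using (length-map; length-++; length-removeAt′)
open import Data.List.Relation.Unary.Any using (here; there; index)
open import Data.List.Relation.Unary.Unique.Propositional using (_∷_)
open import Data.List.Membership.Propositional using (_∈_; _─_)
open import Data.List.Membership.Propositional.Properties
  using (∈-map⁺; ∈-++⁺ˡ; ∈-++⁺ʳ; ∈-cartesianProductWith⁺)
open import Data.List.Relation.Binary.Subset.Propositional using (_⊆_)
import Data.List.Relation.Unary.All as All
open import Data.Product using (_,_)
open import Data.Sum using (_⊎_; inj₁; inj₂)
import Data.Sum as Sum
open import Data.Empty using (⊥-elim)
open import Relation.Binary.PropositionalEquality using (_≡_; _≢_; refl; sym; cong; cong₂; module ≡-Reasoning)

module _ {A : Set} where

  ∈-─⁺ : ∀ {x y} {ys : List A} (x∈ys : x ∈ ys) → y ∈ ys → x ≢ y → y ∈ ys ─ x∈ys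
  ∈-─⁺ (here refl) (here refl) x≢y = ⊥-elim (x≢y refl)
  ∈-─⁺ (here refl) (there y∈ys) _ = y∈ys
  ∈-─⁺ (there x∈ys) (here y≡z) _ = here y≡z
  ∈-─⁺ (there x∈ys) (there y∈ys) x≢y = there (∈-─⁺ x∈ys y∈ys x≢y)

  Unique-⊆⇒length-≤ : {xs ys : List A} → Unique xs → xs ⊆ ys → length xs ≤ length ys
  Unique-⊆⇒length-≤ {[]} _ _ = z≤n
  Unique-⊆⇒length-≤ {x ∷ xs} {ys} (x∉xs ∷ xs!) xs⊆ys = begin
    suc (length xs)           ≤⟨ s≤s (Unique-⊆⇒length-≤ xs! xs⊆ys─x) ⟩
    suc (length (ys ─ x∈ys))  ≡⟨ sym (length-removeAt′ ys (index x∈ys)) ⟩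
    length ys                 ∎
    where
    open ≤-Reasoning
    x∈ys : x ∈ ys
    x∈ys = xs⊆ys (here refl)
    xs⊆ys─x : xs ⊆ ys ─ x∈ys
    xs⊆ys─x y∈xs = ∈-─⁺ x∈ys (xs⊆ys (there y∈xs)) (All.lookup x∉xs y∈xs)

-- Lists of values are kept as z ∷ o ∷ R, with R listing the values other than z and o.
module TwoPointed {A : Set} (z o : A) where

  ∈-union⁺ : ∀ {x} (R₁ R₂ : List A) → x ∈ z ∷ o ∷ R₁ ⊎ x ∈ z ∷ o ∷ R₂ → x ∈ z ∷ o ∷ (R₁ ++ R₂)
  ∈-union⁺ R₁ R₂ (inj₁ (here x≡z)) = here x≡z
  ∈-union⁺ R₁ R₂ (inj₁ (there (here x≡o))) = there (here x≡o)
  ∈-union⁺ R₁ R₂ (inj₁ (there (there x∈R₁))) = there (there (∈-++⁺ˡ x∈R₁))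
  ∈-union⁺ R₁ R₂ (inj₂ (here x≡z)) = here x≡z
  ∈-union⁺ R₁ R₂ (inj₂ (there (here x≡o))) = there (here x≡o)
  ∈-union⁺ R₁ R₂ (inj₂ (there (there x∈R₂))) = there (there (∈-++⁺ʳ R₁ x∈R₂))

  ∈-swap⁺ : (h : A → A) → h z ≡ o → h o ≡ z → ∀ {x} (R : List A) →
    x ∈ z ∷ o ∷ R → h x ∈ z ∷ o ∷ map h R
  ∈-swap⁺ h hz≡o ho≡z R (here refl) = there (here hz≡o)
  ∈-swap⁺ h hz≡o ho≡z R (there (here refl)) = here ho≡z
  ∈-swap⁺ h hz≡o ho≡z R (there (there x∈R)) = there (there (∈-map⁺ h x∈R))

  -- The image of (z ∷ o ∷ R₁) × (z ∷ o ∷ R₂) under h, without the pairs (z , z) and (o , o).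
  productRest : (A → A → A) → List A → List A → List A
  productRest h R₁ R₂ =
    map (h z) (o ∷ R₂) ++ map (h o) (z ∷ R₂) ++ cartesianProductWith h R₁ (z ∷ o ∷ R₂)

  ∈-productRest⁺ : (h : A → A → A) → h z z ≡ z → h o o ≡ o → ∀ {x y} (R₁ R₂ : List A) →
    x ∈ z ∷ o ∷ R₁ → y ∈ z ∷ o ∷ R₂ → h x y ∈ z ∷ o ∷ productRest h R₁ R₂
  ∈-productRest⁺ h hzz≡z hoo≡o R₁ R₂ (here refl) (here refl) = here hzz≡z
  ∈-productRest⁺ h hzz≡z hoo≡o R₁ R₂ (here refl) (there y∈oR₂) =
    there (there (∈-++⁺ˡ (∈-map⁺ (h z) y∈oR₂)))
  ∈-productRest⁺ h hzz≡z hoo≡o R₁ R₂ (there (here refl)) (here refl) =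
    there (there (∈-++⁺ʳ (map (h z) (o ∷ R₂)) (∈-++⁺ˡ {xs = map (h o) (z ∷ R₂)} (here refl))))
  ∈-productRest⁺ h hzz≡z hoo≡o R₁ R₂ (there (here refl)) (there (here refl)) = there (here hoo≡o)
  ∈-productRest⁺ h hzz≡z hoo≡o R₁ R₂ (there (here refl)) (there (there y∈R₂)) =
    there (there (∈-++⁺ʳ (map (h z) (o ∷ R₂)) (∈-++⁺ˡ (there (∈-map⁺ (h o) y∈R₂)))))
  ∈-productRest⁺ h hzz≡z hoo≡o R₁ R₂ (there (there x∈R₁)) y∈zoR₂ =
    there (there (∈-++⁺ʳ (map (h z) (o ∷ R₂)) (∈-++⁺ʳ (map (h o) (z ∷ R₂))
      (∈-cartesianProductWith⁺ h x∈R₁ y∈zoR₂))))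

  length-cartesianProductWith : (h : A → A → A) (xs ys : List A) →
    length (cartesianProductWith h xs ys) ≡ length xs * length ys
  length-cartesianProductWith h [] ys = refl
  length-cartesianProductWith h (x ∷ xs) ys = begin
    length (map (h x) ys ++ cartesianProductWith h xs ys)          ≡⟨ length-++ (map (h x) ys) ⟩
    length (map (h x) ys) + length (cartesianProductWith h xs ys)
      ≡⟨ cong₂ _+_ (length-map (h x) ys) (length-cartesianProductWith h xs ys) ⟩
    length ys + length xs * length ys                               ∎
    where open ≡-Reasoning

  length-productRest : (h : A → A → A) (R₁ R₂ : List A) →
    2 + length (productRest h R₁ R₂) ≡ (2 + length R₁) * (2 + length R₂)
  length-productRest h R₁ R₂
    rewrite length-++ (map (h z) (o ∷ R₂)) {map (h o) (z ∷ R₂) ++ cartesianProductWith h R₁ (z ∷ o ∷ R₂)}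
          | length-++ (map (h o) (z ∷ R₂)) {cartesianProductWith h R₁ (z ∷ o ∷ R₂)}
          | length-map (h z) R₂ | length-map (h o) R₂
          | length-cartesianProductWith h R₁ (z ∷ o ∷ R₂)
          = arith (length R₁) (length R₂)
    where
    arith : ∀ a b → 2 + (suc b + (suc b + a * (2 + b))) ≡ (2 + a) * (2 + b)
    arith = solve-∀

m+n≤m*n+1 : ∀ {m n} → 1 ≤ m → 1 ≤ n → m + n ≤ m * n + 1
m+n≤m*n+1 {suc a} {suc b} _ _ = begin
  suc a + suc b          ≤⟨ m≤m+n (suc a + suc b) (a * b) ⟩
  suc a + suc b + a * b  ≡⟨ arith a b ⟩
  suc a * suc b + 1      ∎
  where
  open ≤-Reasoning
  arith : ∀ a b → suc a + suc b + a * b ≡ suc a * suc b + 1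
  arith = solve-∀

union-bound : ∀ {a b} m n → 2 + a ≤ 2 ^ suc m → 2 + b ≤ 2 ^ suc n → 2 + (a + b) ≤ 2 ^ suc (m + n)
union-bound {a} {b} m n ha hb = +-cancelʳ-≤ 2 _ _ (begin
  2 + (a + b) + 2    ≡⟨ shuffle a b ⟩
  (2 + a) + (2 + b)  ≤⟨ +-mono-≤ ha hb ⟩
  2 * s + 2 * t      ≡⟨ sym (*-distribˡ-+ 2 s t) ⟩
  2 * (s + t)        ≤⟨ *-monoʳ-≤ 2 (m+n≤m*n+1 (m^n>0 2 m) (m^n>0 2 n)) ⟩
  2 * (s * t + 1)    ≡⟨ *-distribˡ-+ 2 (s * t) 1 ⟩
  2 * (s * t) + 2    ≡⟨ cong (λ k → 2 * k + 2) (sym (^-distribˡ-+-* 2 m n)) ⟩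
  2 ^ suc (m + n) + 2 ∎)
  where
  open ≤-Reasoning
  s t : ℕ
  s = 2 ^ m
  t = 2 ^ n
  shuffle : ∀ a b → 2 + (a + b) + 2 ≡ (2 + a) + (2 + b)
  shuffle = solve-∀

product-bound : ∀ {a b} m n → a ≤ 2 ^ suc m → b ≤ 2 ^ suc n → a * b ≤ 2 ^ suc (suc (m + n))
product-bound {a} {b} m n ha hb = begin
  a * b                    ≤⟨ *-mono-≤ ha hb ⟩
  2 ^ suc m * 2 ^ suc n    ≡⟨ sym (^-distribˡ-+-* 2 (suc m) (suc n)) ⟩
  2 ^ (suc m + suc n)      ≡⟨ cong (λ k → 2 ^ suc k) (+-suc m n) ⟩
  2 ^ suc (suc (m + n))    ∎
  where open ≤-Reasoning

q+[1-q]≡1 : ∀ q → q +ℚ (1ℚ -ℚ q) ≡ 1ℚ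
q+[1-q]≡1 q = begin
  q +ℚ (1ℚ +ℚ - q)   ≡⟨ cong (q +ℚ_) (ℚ.+-comm 1ℚ (- q)) ⟩
  q +ℚ (- q +ℚ 1ℚ)   ≡⟨ sym (ℚ.+-assoc q (- q) 1ℚ) ⟩
  (q +ℚ - q) +ℚ 1ℚ   ≡⟨ cong (_+ℚ 1ℚ) (ℚ.+-inverseʳ q) ⟩
  0ℚ +ℚ 1ℚ           ∎
  where open ≡-Reasoning

convex : ℚ → ℚ → ℚ → ℚ
convex q x y = q *ℚ x +ℚ (1ℚ -ℚ q) *ℚ y

convex-idem : ∀ q x → convex q x x ≡ x
convex-idem q x = begin
  q *ℚ x +ℚ (1ℚ -ℚ q) *ℚ x  ≡⟨ sym (ℚ.*-distribʳ-+ x q (1ℚ -ℚ q)) ⟩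
  (q +ℚ (1ℚ -ℚ q)) *ℚ x     ≡⟨ cong (_*ℚ x) (q+[1-q]≡1 q) ⟩
  1ℚ *ℚ x                   ≡⟨ ℚ.*-identityˡ x ⟩
  x                         ∎
  where open ≡-Reasoning

open TwoPointed 0ℚ 1ℚ

module _ {Φ : Set} {Pure : Φ → Set} {V : Set} where

  -- Covers the values of Eval f other than 0 and 1; it may contain repetitions and spurious entries.
  rest : QSL Φ Pure V → List ℚ
  rest [ _ ] = []
  rest (guarded _ _ g u) = rest g ++ rest u
  rest (pchoice q _ _ g u) = productRest (convex q) (rest g) (rest u)
  rest (mul g u) = productRest _*ℚ_ (rest g) (rest u)
  rest (oneMinus g) = map (1ℚ -ℚ_) (rest g)
  rest (qmax g u) = rest g ++ rest u
  rest (qmin g u) = rest g ++ rest u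
  rest (supx _ g) = rest g
  rest (infx _ g) = rest g
  rest (sepcon g u) = productRest _*ℚ_ (rest g) (rest u)
  rest (wand _ g) = rest g

  Eval⇒∈01∷rest : (f : QSL Φ Pure V) {β : ℚ} → Eval f β → β ∈ 0ℚ ∷ 1ℚ ∷ rest f
  Eval⇒∈01∷rest [ _ ] (inj₁ β≡0) = here β≡0
  Eval⇒∈01∷rest [ _ ] (inj₂ β≡1) = there (here β≡1)
  Eval⇒∈01∷rest (guarded _ _ g u) β∈ =
    ∈-union⁺ (rest g) (rest u) (Sum.map (Eval⇒∈01∷rest g) (Eval⇒∈01∷rest u) β∈)
  Eval⇒∈01∷rest (pchoice q _ _ g u) (_ , _ , x∈ , y∈ , refl) =
    ∈-productRest⁺ (convex q) (convex-idem q 0ℚ) (convex-idem q 1ℚ) (rest g) (rest u)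
      (Eval⇒∈01∷rest g x∈) (Eval⇒∈01∷rest u y∈)
  Eval⇒∈01∷rest (mul g u) (_ , _ , x∈ , y∈ , refl) =
    ∈-productRest⁺ _*ℚ_ refl refl (rest g) (rest u) (Eval⇒∈01∷rest g x∈) (Eval⇒∈01∷rest u y∈)
  Eval⇒∈01∷rest (oneMinus g) (_ , x∈ , refl) = ∈-swap⁺ (1ℚ -ℚ_) refl refl (rest g) (Eval⇒∈01∷rest g x∈)
  Eval⇒∈01∷rest (qmax g u) β∈ =
    ∈-union⁺ (rest g) (rest u) (Sum.map (Eval⇒∈01∷rest g) (Eval⇒∈01∷rest u) β∈)
  Eval⇒∈01∷rest (qmin g u) β∈ =
    ∈-union⁺ (rest g) (rest u) (Sum.map (Eval⇒∈01∷rest g) (Eval⇒∈01∷rest u) β∈)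
  Eval⇒∈01∷rest (supx _ g) β∈ = Eval⇒∈01∷rest g β∈
  Eval⇒∈01∷rest (infx _ g) β∈ = Eval⇒∈01∷rest g β∈
  Eval⇒∈01∷rest (sepcon g u) (_ , _ , x∈ , y∈ , refl) =
    ∈-productRest⁺ _*ℚ_ refl refl (rest g) (rest u) (Eval⇒∈01∷rest g x∈) (Eval⇒∈01∷rest u y∈)
  Eval⇒∈01∷rest (wand _ g) β∈ = Eval⇒∈01∷rest g β∈

  length-rest≤ : (f : QSL Φ Pure V) → 2 + length (rest f) ≤ 2 ^ suc (psize f)

  length-union≤ : (g u : QSL Φ Pure V) → 2 + length (rest g ++ rest u) ≤ 2 ^ suc (psize g + psize u)
  length-union≤ g u rewrite length-++ (rest g) {rest u} =
    union-bound (psize g) (psize u) (length-rest≤ g) (length-rest≤ u)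

  length-productRest≤ : (h : ℚ → ℚ → ℚ) (g u : QSL Φ Pure V) →
    2 + length (productRest h (rest g) (rest u)) ≤ 2 ^ suc (suc (psize g + psize u))
  length-productRest≤ h g u rewrite length-productRest h (rest g) (rest u) =
    product-bound (psize g) (psize u) (length-rest≤ g) (length-rest≤ u)

  length-rest≤ [ _ ] = ≤-refl
  length-rest≤ (guarded _ _ g u) = length-union≤ g u
  length-rest≤ (pchoice q _ _ g u) = length-productRest≤ (convex q) g u
  length-rest≤ (mul g u) = length-productRest≤ _*ℚ_ g u
  length-rest≤ (oneMinus g) rewrite length-map (1ℚ -ℚ_) (rest g) = length-rest≤ g
  length-rest≤ (qmax g u) = length-union≤ g u
  length-rest≤ (qmin g u) = length-union≤ g u
  length-rest≤ (supx _ g) = length-rest≤ g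
  length-rest≤ (infx _ g) = length-rest≤ g
  length-rest≤ (sepcon g u) = length-productRest≤ _*ℚ_ g u
  length-rest≤ (wand _ g) = length-rest≤ g

mainTheorem5 : {Φ : Set} {Pure : Φ → Set} {V : Set} (f : QSL Φ Pure V) →
    (xs : List ℚ) → Unique xs → All (Eval f) xs → length xs ≤ 2 ^ (psize f + 1)
mainTheorem5 f xs xs! xs⊆Eval = begin
  length xs                ≤⟨ Unique-⊆⇒length-≤ xs! (λ x∈xs → Eval⇒∈01∷rest f (All.lookup xs⊆Eval x∈xs)) ⟩
  2 + length (rest f)      ≤⟨ length-rest≤ f ⟩
  2 ^ suc (psize f)        ≡⟨ cong (2 ^_) (+-comm 1 (psize f)) ⟩
  2 ^ (psize f + 1)        ∎
  where open ≤-Reasoning
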